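{- Let $p\ge0$ be an integer and $n,k\ge0$ integers with $n\ge (p+1)k$, and let $\gamma_{n,k}=0^{n-k}1^k$. For every $\alpha\in C_n(p,k)$ with $\alpha\ne\gamma_{n,k}$, the list $\mathcal{D}_p(\alpha)$ ends with $\gamma_{n,k}$.
   Context: $C_n(p,k)$ is the set of binary words of length $n$ with exactly $k$ ones such that every prefix contains at least $p$ times as many 0's as 1's. Two binary words differ by a homogeneous transposition if one is obtained from the other by transposing a 1 with a 0 with no 1's between the transposed positions. For a set $S$ of same-length, same-weight binary words and $\alpha\in S$, the greedy Gray code algorithm for $S$ applied to $\alpha$ builds a list $\mathcal L$ as follows: initialize $\mathcal L=(\alpha)$; repeatedly, for the last word of $\mathcal L$, homogeneously transpose the leftmost possible 1 with the leftmost possible 0 such that the resulting word is in $S$ but not already in $\mathcal L$, and append it to $\mathcal L$; stop when no such new word exists. $\mathcal{D}_p(\alpha)$ denotes the list obtained by applying this algorithm for $S=C_n(p,k)$ to $\alpha$. -}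

module Defs where

open import Data.Bool using (Bool; true; false; if_then_else_)
open import Data.Nat using (ℕ; zero; suc; _+_; _*_; _∸_; _^_; _≤_; _⊔_; _⊓_)
open import Data.Nat.Properties using (_≟_; _≤?_)
open import Data.List using (List; []; _∷_; _++_; length; replicate; inits; take; drop; upTo; concatMap; map)
open import Data.List.Relation.Unary.All using (All; all?)
open import Data.List.Relation.Unary.Any using (any?)
import Data.List.Properties as LP
import Data.Bool.Properties as BP
open import Data.List.Membership.DecPropositional (LP.≡-dec BP._≟_) using (_∈?_)
open import Data.Maybe using (Maybe; just; nothing)
open import Data.Product using (_×_; _,_)
open import Relation.Binary.PropositionalEquality using (_≡_)
open import Relation.Nullary using (Dec; yes; no; ¬_)
open import Relation.Nullary.Decidable using (_×-dec_)

-- Binary words: lists of bits; true = 1, false = 0.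
Word : Set
Word = List Bool

isOne : Bool → Bool
isOne b = b

isZero : Bool → Bool
isZero true = false
isZero false = true

ones : Word → ℕ
ones [] = 0
ones (true ∷ w) = suc (ones w)
ones (false ∷ w) = ones w

zeros : Word → ℕ
zeros [] = 0
zeros (true ∷ w) = zeros w
zeros (false ∷ w) = suc (zeros w)

InC : ℕ → ℕ → ℕ → Word → Set
InC n p k w = (length w ≡ n) × (ones w ≡ k) × All (λ u → p * ones u ≤ zeros u) (inits w)

InC? : (n p k : ℕ) → (w : Word) → Dec (InC n p k w)
InC? n p k w = (length w ≟ n) ×-dec ((ones w ≟ k) ×-dec all? (λ u → p * ones u ≤? zeros u) (inits w))

γ : ℕ → ℕ → Word
γ n k = replicate (n ∸ k) false ++ replicate k true

-- bit at position i (0-based); false when out of range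
bitAt : Word → ℕ → Bool
bitAt [] _ = false
bitAt (b ∷ w) zero = b
bitAt (b ∷ w) (suc i) = bitAt w i

setAt : Word → ℕ → Bool → Word
setAt [] _ _ = []
setAt (b ∷ w) zero c = c ∷ w
setAt (b ∷ w) (suc i) c = b ∷ setAt w i c

strictlyBetween : Word → ℕ → ℕ → Word
strictlyBetween w i j = drop (suc (i ⊓ j)) (take (i ⊔ j) w)

noOnes : Word → Bool
noOnes [] = true
noOnes (true ∷ w) = false
noOnes (false ∷ w) = noOnes w

homog : Word → ℕ → ℕ → Bool
homog w i j =
  if bitAt w i
  then (if bitAt w j then false else noOnes (strictlyBetween w i j))
  else false

transpose : Word → ℕ → ℕ → Word
transpose w i j = setAt (setAt w i false) j true

-- candidate pairs (i , j), ordered by position of the 1 first (leftmost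
-- first), then by position of the 0 (leftmost first).
pairs : ℕ → List (ℕ × ℕ)
pairs n = concatMap (λ i → map (λ j → (i , j)) (upTo n)) (upTo n)

firstNew : ℕ → ℕ → ℕ → List Word → Word → List (ℕ × ℕ) → Maybe Word
firstNew n p k L w [] = nothing
firstNew n p k L w ((i , j) ∷ ps) with homog w i j
... | false = firstNew n p k L w ps
... | true with InC? n p k (transpose w i j)
...   | no _ = firstNew n p k L w ps
...   | yes _ with (transpose w i j) ∈? L
...     | yes _ = firstNew n p k L w ps
...     | no _ = just (transpose w i j)

-- next word appended by the greedy algorithm (w is the last word of L)
greedyNext : ℕ → ℕ → ℕ → List Word → Word → Maybe Word
greedyNext n p k L w = firstNew n p k L w (pairs n)

run : ℕ → ℕ → ℕ → ℕ → List Word → Word → List Word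
run n p k zero L w = L
run n p k (suc f) L w with greedyNext n p k L w
... | nothing = L
... | just w' = run n p k f (L ++ (w' ∷ [])) w'

-- D_p(α) for S = C_n(p,k).  Each step appends a new distinct word of
-- length n, so at most 2^n - 1 steps occur; fuel 2^n is never exhausted.
D : ℕ → ℕ → ℕ → Word → List Word
D p n k α = run n p k (2 ^ n) (α ∷ []) α

-- Call the ones at the end of a word its trailing ones. A word of C_n(p,k) other than
-- γ = 0^a 1^k (a = n - k) has the form x 1 0^(m+1) 1^b, and sliding that 1 to the end of its
-- zero block is a homogeneous transposition that stays in C_n(p,k) and produces b + 1 trailing
-- ones. Along the greedy list the number of trailing ones never decreases: the greedy choice
-- moves a 1 lying no further right than the one being slid, so it leaves the final 1^b
-- intact. Hence the slid word is always new and the algorithm cannot stop before reaching γ.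
-- When γ is appended, the previous word w is γ with the 1 at a moved to some i < a. A
-- homogeneous transposition of γ moves the 1 at a to some j < a; for j = i it gives back w,
-- and otherwise the transposition (i, j) of w gives the same word and would have been
-- preferred to (i, a). So the list ends with γ, and the fuel 2^n suffices since the list
-- consists of distinct words of length n.

module Submission where

open import Defs
open import Data.Bool using (Bool; true; false)
open import Data.Bool.Properties using () renaming (_≟_ to _≟ᵇ_)
open import Data.Empty using (⊥; ⊥-elim)
open import Data.List using (List; []; _∷_; _++_; [_]; length; replicate; map; upTo; last; take; drop; inits)
open import Data.List.Properties using (++-assoc; length-++; length-map; length-replicate; ≡-dec)
open import Data.List.Membership.Propositional using (_∈_; _∉_; find)
open import Data.List.Membership.Propositional.Properties
  using (∈-∃++; ∈-++⁻; ∈-++⁺ˡ; ∈-++⁺ʳ; ∈-map⁺; ∈-map⁻; ∈-upTo⁺; ∈-upTo⁻;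
         ∈-concatMap⁺; ∈-concatMap⁻)
open import Data.List.Membership.DecPropositional (≡-dec _≟ᵇ_) using (_∈?_)
open import Data.List.Relation.Binary.Subset.Propositional using (_⊆_)
open import Data.List.Relation.Unary.All as All using (All; []; _∷_)
open import Data.List.Relation.Unary.All.Properties using (∷ʳ⁺; map⁺; map⁻)
open import Data.List.Relation.Unary.Any as Any using (here; there)
open import Data.List.Relation.Unary.AllPairs using (AllPairs; []; _∷_)
import Data.List.Relation.Unary.AllPairs.Properties as AllPairs
open import Data.List.Relation.Unary.Unique.Propositional using (Unique)
import Data.List.Relation.Unary.Unique.Propositional.Properties as Unique
open import Data.Maybe using (Maybe; just; nothing)
open import Data.Maybe.Properties using (just-injective)
open import Data.Nat
open import Data.Nat.Properties
open import Data.Product using (_×_; _,_; ∃; proj₁; proj₂)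
open import Data.Product.Relation.Binary.Lex.Strict using (×-Lex; ×-asymmetric)
open import Data.Sum using (inj₁; inj₂)
open import Relation.Binary.PropositionalEquality
  using (_≡_; _≢_; refl; sym; trans; cong; cong₂; subst; module ≡-Reasoning)
open import Relation.Nullary using (¬_; Dec; yes; no)

falses trues : ℕ → Word
falses m = replicate m false
trues m = replicate m true

false≢true : false ≢ true
false≢true ()

replicate-+ : ∀ a b (c : Bool) → replicate (a + b) c ≡ replicate a c ++ replicate b c
replicate-+ zero b c = refl
replicate-+ (suc a) b c = cong (c ∷_) (replicate-+ a b c)

falses-suc-++ : ∀ m (y : Word) → falses (suc m) ++ y ≡ falses m ++ false ∷ y
falses-suc-++ zero y = refl
falses-suc-++ (suc m) y = cong (false ∷_) (falses-suc-++ m y)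

length-falses-++ : ∀ s (y : Word) → length (falses s ++ y) ≡ s + length y
length-falses-++ zero y = refl
length-falses-++ (suc s) y = cong suc (length-falses-++ s y)

ones-falses-++ : ∀ s (y : Word) → ones (falses s ++ y) ≡ ones y
ones-falses-++ zero y = refl
ones-falses-++ (suc s) y = ones-falses-++ s y

ones-trues : ∀ b → ones (trues b) ≡ b
ones-trues zero = refl
ones-trues (suc b) = cong suc (ones-trues b)

bitAt-++ʳ : ∀ (xs ys : Word) r → bitAt (xs ++ ys) (length xs + r) ≡ bitAt ys r
bitAt-++ʳ [] ys r = refl
bitAt-++ʳ (x ∷ xs) ys r = bitAt-++ʳ xs ys r

bitAt-falses-++ : ∀ s (y : Word) {r} → r < s → bitAt (falses s ++ y) r ≡ false
bitAt-falses-++ (suc s) y {zero} _ = refl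
bitAt-falses-++ (suc s) y {suc r} (s≤s r<s) = bitAt-falses-++ s y r<s

bitAt-falses-++-+ : ∀ s (y : Word) r → bitAt (falses s ++ y) (s + r) ≡ bitAt y r
bitAt-falses-++-+ zero y r = refl
bitAt-falses-++-+ (suc s) y r = bitAt-falses-++-+ s y r

bitAt-trues : ∀ s {r} → r < s → bitAt (trues s) r ≡ true
bitAt-trues (suc s) {zero} _ = refl
bitAt-trues (suc s) {suc r} (s≤s r<s) = bitAt-trues s r<s

length-setAt : ∀ (w : Word) i c → length (setAt w i c) ≡ length w
length-setAt [] i c = refl
length-setAt (x ∷ w) zero c = refl
length-setAt (x ∷ w) (suc i) c = cong suc (length-setAt w i c)

bitAt-setAt-≡ : ∀ (w : Word) {i} c → i < length w → bitAt (setAt w i c) i ≡ c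
bitAt-setAt-≡ (x ∷ w) {zero} c _ = refl
bitAt-setAt-≡ (x ∷ w) {suc i} c (s≤s i<n) = bitAt-setAt-≡ w c i<n

bitAt-setAt-false : ∀ (w : Word) i → bitAt (setAt w i false) i ≡ false
bitAt-setAt-false [] i = refl
bitAt-setAt-false (x ∷ w) zero = refl
bitAt-setAt-false (x ∷ w) (suc i) = bitAt-setAt-false w i

bitAt-setAt-≢ : ∀ (w : Word) {i m} c → m ≢ i → bitAt (setAt w i c) m ≡ bitAt w m
bitAt-setAt-≢ [] c m≢i = refl
bitAt-setAt-≢ (x ∷ w) {zero} {zero} c m≢i = ⊥-elim (m≢i refl)
bitAt-setAt-≢ (x ∷ w) {zero} {suc m} c m≢i = refl
bitAt-setAt-≢ (x ∷ w) {suc i} {zero} c m≢i = refl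
bitAt-setAt-≢ (x ∷ w) {suc i} {suc m} c m≢i = bitAt-setAt-≢ w c (λ m≡i → m≢i (cong suc m≡i))

setAt-idem : ∀ (w : Word) i b c → setAt (setAt w i b) i c ≡ setAt w i c
setAt-idem [] i b c = refl
setAt-idem (x ∷ w) zero b c = refl
setAt-idem (x ∷ w) (suc i) b c = cong (x ∷_) (setAt-idem w i b c)

setAt-comm : ∀ (w : Word) {i j} b c → i ≢ j → setAt (setAt w i b) j c ≡ setAt (setAt w j c) i b
setAt-comm [] b c i≢j = refl
setAt-comm (x ∷ w) {zero} {zero} b c i≢j = ⊥-elim (i≢j refl)
setAt-comm (x ∷ w) {zero} {suc j} b c i≢j = refl
setAt-comm (x ∷ w) {suc i} {zero} b c i≢j = refl
setAt-comm (x ∷ w) {suc i} {suc j} b c i≢j = cong (x ∷_) (setAt-comm w b c (λ i≡j → i≢j (cong suc i≡j)))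

setAt-bitAt : ∀ (w : Word) i {b} → bitAt w i ≡ b → setAt w i b ≡ w
setAt-bitAt [] i e = refl
setAt-bitAt (x ∷ w) zero refl = refl
setAt-bitAt (x ∷ w) (suc i) e = cong (x ∷_) (setAt-bitAt w i e)

setAt-++ˡ : ∀ (y r : Word) {i} c → i < length y → setAt (y ++ r) i c ≡ setAt y i c ++ r
setAt-++ˡ (x ∷ y) r {zero} c _ = refl
setAt-++ˡ (x ∷ y) r {suc i} c (s≤s i<n) = cong (x ∷_) (setAt-++ˡ y r c i<n)

setAt-trues : ∀ s r → setAt (trues s) r true ≡ trues s
setAt-trues zero r = refl
setAt-trues (suc s) zero = refl
setAt-trues (suc s) (suc r) = cong (true ∷_) (setAt-trues s r)

bitAt-transpose-source : ∀ (w : Word) {i j} → i ≢ j → bitAt (transpose w i j) i ≡ false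
bitAt-transpose-source w {i} i≢j = trans (bitAt-setAt-≢ (setAt w i false) true i≢j) (bitAt-setAt-false w i)

bitAt-transpose-target : ∀ (w : Word) i {j} → j < length w → bitAt (transpose w i j) j ≡ true
bitAt-transpose-target w i j<n = bitAt-setAt-≡ (setAt w i false) true (subst (_ <_) (sym (length-setAt w i false)) j<n)

bitAt-transpose-other : ∀ (w : Word) {i j m} → m ≢ i → m ≢ j → bitAt (transpose w i j) m ≡ bitAt w m
bitAt-transpose-other w {i} m≢i m≢j =
  trans (bitAt-setAt-≢ (setAt w i false) true m≢j) (bitAt-setAt-≢ w false m≢i)

transpose-involutive : ∀ (w : Word) {i j} → bitAt w i ≡ true → bitAt w j ≡ false → i ≢ j →
                       transpose (transpose w i j) j i ≡ w
transpose-involutive w {i} {j} wi wj i≢j = begin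
  setAt (setAt (setAt (setAt w i false) j true) j false) i true
    ≡⟨ cong (λ u → setAt u i true) (setAt-idem (setAt w i false) j true false) ⟩
  setAt (setAt (setAt w i false) j false) i true
    ≡⟨ cong (λ u → setAt u i true) (setAt-comm w false false i≢j) ⟩
  setAt (setAt (setAt w j false) i false) i true
    ≡⟨ setAt-idem (setAt w j false) i false true ⟩
  setAt (setAt w j false) i true
    ≡⟨ setAt-bitAt (setAt w j false) i (trans (bitAt-setAt-≢ w false i≢j) wi) ⟩
  setAt w j false
    ≡⟨ setAt-bitAt w j wj ⟩
  w ∎
  where open ≡-Reasoning

transpose-transpose : ∀ (w : Word) {a i} j → i ≢ a → bitAt w i ≡ false →
                      transpose (transpose w a i) i j ≡ transpose w a j
transpose-transpose w {a} {i} j i≢a wi = begin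
  setAt (setAt (setAt (setAt w a false) i true) i false) j true
    ≡⟨ cong (λ u → setAt u j true) (setAt-idem (setAt w a false) i true false) ⟩
  setAt (setAt (setAt w a false) i false) j true
    ≡⟨ cong (λ u → setAt u j true) (setAt-bitAt (setAt w a false) i (trans (bitAt-setAt-≢ w false i≢a) wi)) ⟩
  setAt (setAt w a false) j true ∎
  where open ≡-Reasoning

-- Homogeneous transpositions

Between : ℕ → ℕ → ℕ → Set
Between i j m = i ⊓ j < m × m < i ⊔ j

between-sym : ∀ {i j m} → Between i j m → Between j i m
between-sym {i} {j} (lo , hi) = subst (_< _) (⊓-comm i j) lo , subst (_ <_) (⊔-comm i j) hi

between-≢ˡ : ∀ {i j m} → Between i j m → m ≢ i
between-≢ˡ {i} {j} (lo , hi) refl with ≤-total i j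
... | inj₁ i≤j = <-irrefl (m≤n⇒m⊓n≡m i≤j) lo
... | inj₂ j≤i = <-irrefl (sym (m≥n⇒m⊔n≡m j≤i)) hi

between-≢ʳ : ∀ {i j m} → Between i j m → m ≢ j
between-≢ʳ b = between-≢ˡ (between-sym b)

record Homogeneous (w : Word) (i j : ℕ) : Set where
  field
    one-at : bitAt w i ≡ true
    zero-at : bitAt w j ≡ false
    zeros-between : ∀ {m} → Between i j m → bitAt w m ≡ false

  source≢target : i ≢ j
  source≢target refl = false≢true (trans (sym zero-at) one-at)

open Homogeneous

noOnes-sound : ∀ xs → noOnes xs ≡ true → ∀ r → bitAt xs r ≡ false
noOnes-sound [] _ r = refl
noOnes-sound (false ∷ xs) _ zero = refl
noOnes-sound (false ∷ xs) h (suc r) = noOnes-sound xs h r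

noOnes-complete : ∀ xs → (∀ r → bitAt xs r ≡ false) → noOnes xs ≡ true
noOnes-complete [] _ = refl
noOnes-complete (true ∷ xs) h with h 0
... | ()
noOnes-complete (false ∷ xs) h = noOnes-complete xs (λ r → h (suc r))

bitAt-drop : ∀ (xs : Word) d r → bitAt (drop d xs) r ≡ bitAt xs (d + r)
bitAt-drop xs zero r = refl
bitAt-drop [] (suc d) r = refl
bitAt-drop (x ∷ xs) (suc d) r = bitAt-drop xs d r

bitAt-take-< : ∀ (xs : Word) {t r} → r < t → bitAt (take t xs) r ≡ bitAt xs r
bitAt-take-< [] {suc t} r<t = refl
bitAt-take-< (x ∷ xs) {suc t} {zero} r<t = refl
bitAt-take-< (x ∷ xs) {suc t} {suc r} (s≤s r<t) = bitAt-take-< xs r<t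

bitAt-take-≥ : ∀ (xs : Word) {t r} → t ≤ r → bitAt (take t xs) r ≡ false
bitAt-take-≥ xs {zero} t≤r = refl
bitAt-take-≥ [] {suc t} t≤r = refl
bitAt-take-≥ (x ∷ xs) {suc t} (s≤s t≤r) = bitAt-take-≥ xs t≤r

noOnes-strictlyBetween-sound : ∀ w i j → noOnes (strictlyBetween w i j) ≡ true →
                               ∀ {m} → Between i j m → bitAt w m ≡ false
noOnes-strictlyBetween-sound w i j h (lo , hi) with m≤n⇒∃[o]m+o≡n lo
... | r , refl = begin
  bitAt w (suc (i ⊓ j) + r)                         ≡⟨ bitAt-take-< w hi ⟨
  bitAt (take (i ⊔ j) w) (suc (i ⊓ j) + r)          ≡⟨ bitAt-drop (take (i ⊔ j) w) (suc (i ⊓ j)) r ⟨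
  bitAt (strictlyBetween w i j) r                   ≡⟨ noOnes-sound (strictlyBetween w i j) h r ⟩
  false                                             ∎
  where open ≡-Reasoning

noOnes-strictlyBetween-complete : ∀ w i j → (∀ {m} → Between i j m → bitAt w m ≡ false) →
                                  noOnes (strictlyBetween w i j) ≡ true
noOnes-strictlyBetween-complete w i j h =
  noOnes-complete (strictlyBetween w i j) λ r → trans (bitAt-drop (take (i ⊔ j) w) (suc (i ⊓ j)) r) (window r)
  where
  window : ∀ r → bitAt (take (i ⊔ j) w) (suc (i ⊓ j) + r) ≡ false
  window r with suc (i ⊓ j) + r <? i ⊔ j
  ... | yes hi = trans (bitAt-take-< w hi) (h (s≤s (m≤m+n (i ⊓ j) r) , hi))
  ... | no ¬hi = bitAt-take-≥ w (≮⇒≥ ¬hi)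

homog-sound : ∀ w i j → homog w i j ≡ true → Homogeneous w i j
homog-sound w i j h with bitAt w i in wi | bitAt w j in wj
homog-sound w i j () | false | _
homog-sound w i j () | true | true
... | true | false = record
  { one-at = wi ; zero-at = wj ; zeros-between = noOnes-strictlyBetween-sound w i j h }

homog-complete : ∀ {w i j} → Homogeneous w i j → homog w i j ≡ true
homog-complete {w} {i} {j} h rewrite one-at h | zero-at h =
  noOnes-strictlyBetween-complete w i j (zeros-between h)

homogeneous-reverse : ∀ {w i j} → j < length w → Homogeneous w i j → Homogeneous (transpose w i j) j i
homogeneous-reverse {w} {i} j<n h = record
  { one-at = bitAt-transpose-target w i j<n
  ; zero-at = bitAt-transpose-source w (source≢target h)
  ; zeros-between = λ b → trans (bitAt-transpose-other w (between-≢ʳ b) (between-≢ˡ b))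
                                (zeros-between h (between-sym b))
  }

homogeneous-∷ : ∀ {w i j} c → Homogeneous w i j → Homogeneous (c ∷ w) (suc i) (suc j)
homogeneous-∷ c h = record
  { one-at = one-at h
  ; zero-at = zero-at h
  ; zeros-between = λ { {zero} (() , _) ; {suc m} (s≤s lo , s≤s hi) → zeros-between h (lo , hi) }
  }

-- Sliding a one rightwards across a block of zeros

slide-homogeneous : ∀ x m y → Homogeneous (x ++ true ∷ falses (suc m) ++ y) (length x) (length x + suc m)
slide-homogeneous [] m y = record
  { one-at = refl
  ; zero-at = bitAt-falses-++ (suc m) y ≤-refl
  ; zeros-between = λ { {zero} (() , _) ; {suc r} (_ , s≤s r<m) → bitAt-falses-++ (suc m) y (m<n⇒m<1+n r<m) }
  }
slide-homogeneous (c ∷ x) m y = homogeneous-∷ c (slide-homogeneous x m y)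

setAt-falses-++ : ∀ m (y : Word) → setAt (falses (suc m) ++ y) m true ≡ falses m ++ true ∷ y
setAt-falses-++ zero y = refl
setAt-falses-++ (suc m) y = cong (false ∷_) (setAt-falses-++ m y)

slide-transpose : ∀ x m (y : Word) →
  transpose (x ++ true ∷ falses (suc m) ++ y) (length x) (length x + suc m) ≡ x ++ falses (suc m) ++ true ∷ y
slide-transpose [] m y = cong (false ∷_) (setAt-falses-++ m y)
slide-transpose (c ∷ x) m y = cong (c ∷_) (slide-transpose x m y)

slide-length : ∀ x s (y : Word) → length (x ++ falses s ++ true ∷ y) ≡ length (x ++ true ∷ falses s ++ y)
slide-length [] zero y = refl
slide-length [] (suc s) y = cong suc (slide-length [] s y)
slide-length (c ∷ x) s y = cong suc (slide-length x s y)

slide-ones : ∀ x s (y : Word) → ones (x ++ falses s ++ true ∷ y) ≡ ones (x ++ true ∷ falses s ++ y)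
slide-ones [] zero y = refl
slide-ones [] (suc s) y = slide-ones [] s y
slide-ones (true ∷ x) s y = cong suc (slide-ones x s y)
slide-ones (false ∷ x) s y = slide-ones x s y

slide-target<length : ∀ x m (y : Word) → length x + suc m < length (x ++ true ∷ falses (suc m) ++ y)
slide-target<length [] m y = s≤s (subst (suc m ≤_) (sym (length-falses-++ (suc m) y)) (m≤m+n (suc m) (length y)))
slide-target<length (c ∷ x) m y = s≤s (slide-target<length x m y)

slidable-≡-zero : ∀ x m (y : Word) → x ++ true ∷ falses (suc m) ++ y ≡ (x ++ true ∷ falses m) ++ false ∷ y
slidable-≡-zero x m y =
  trans (cong (λ u → x ++ true ∷ u) (falses-suc-++ m y)) (sym (++-assoc x (true ∷ falses m) (false ∷ y)))

slidable-≡-block : ∀ x m (y : Word) → x ++ true ∷ falses (suc m) ++ y ≡ (x ++ true ∷ falses (suc m)) ++ y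
slidable-≡-block x m y = sym (++-assoc x (true ∷ falses (suc m)) y)

module _ (p : ℕ) where

  Prefix : ℕ → ℕ → Word → Set
  Prefix o z u = p * (o + ones u) ≤ z + zeros u

  Prefix-∷-true : ∀ o z u → Prefix o z (true ∷ u) ≡ Prefix (suc o) z u
  Prefix-∷-true o z u = cong (λ a → p * a ≤ z + zeros u) (+-suc o (ones u))

  Prefix-∷-false : ∀ o z u → Prefix o z (false ∷ u) ≡ Prefix o (suc z) u
  Prefix-∷-false o z u = cong (p * (o + ones u) ≤_) (+-suc z (zeros u))

  -- The prefix condition of InC for w read after o ones and z zeros.
  Ballot : ℕ → ℕ → Word → Set
  Ballot o z [] = Prefix o z []
  Ballot o z (true ∷ w) = Prefix o z [] × Ballot (suc o) z w
  Ballot o z (false ∷ w) = Prefix o z [] × Ballot o (suc z) w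

  All-inits⇒Ballot : ∀ o z w → All (Prefix o z) (inits w) → Ballot o z w
  All-inits⇒Ballot o z [] (h ∷ _) = h
  All-inits⇒Ballot o z (true ∷ w) (h ∷ t) =
    h , All-inits⇒Ballot (suc o) z w (All.map (λ {u} → subst (λ P → P) (Prefix-∷-true o z u)) (map⁻ t))
  All-inits⇒Ballot o z (false ∷ w) (h ∷ t) =
    h , All-inits⇒Ballot o (suc z) w (All.map (λ {u} → subst (λ P → P) (Prefix-∷-false o z u)) (map⁻ t))

  Ballot⇒All-inits : ∀ o z w → Ballot o z w → All (Prefix o z) (inits w)
  Ballot⇒All-inits o z [] h = h ∷ []
  Ballot⇒All-inits o z (true ∷ w) (h , t) =
    h ∷ map⁺ (All.map (λ {u} → subst (λ P → P) (sym (Prefix-∷-true o z u))) (Ballot⇒All-inits (suc o) z w t))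
  Ballot⇒All-inits o z (false ∷ w) (h , t) =
    h ∷ map⁺ (All.map (λ {u} → subst (λ P → P) (sym (Prefix-∷-false o z u))) (Ballot⇒All-inits o (suc z) w t))

  ballot-shift : ∀ s {o z} (y : Word) → Prefix o z [] → Ballot (suc o) z (falses s ++ y) →
                 Ballot o z (falses s ++ true ∷ y)
  ballot-shift zero y h t = h , t
  ballot-shift (suc s) {z = z} y h (_ , t) = h , ballot-shift s y (≤-trans h (n≤1+n (z + 0))) t

  ballot-slide : ∀ x s (y : Word) {o z} → Ballot o z (x ++ true ∷ falses s ++ y) →
                 Ballot o z (x ++ falses s ++ true ∷ y)
  ballot-slide [] s y (h , t) = ballot-shift s y h t
  ballot-slide (true ∷ x) s y (h , t) = h , ballot-slide x s y t
  ballot-slide (false ∷ x) s y (h , t) = h , ballot-slide x s y t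

InC-slide : ∀ {n p k} x s (y : Word) → InC n p k (x ++ true ∷ falses s ++ y) →
            InC n p k (x ++ falses s ++ true ∷ y)
InC-slide {p = p} x s y (len , ones≡ , prefixes) =
  trans (slide-length x s y) len ,
  trans (slide-ones x s y) ones≡ ,
  Ballot⇒All-inits p 0 0 _ (ballot-slide p x s y (All-inits⇒Ballot p 0 0 _ prefixes))

-- Moves into and out of γ n k

γ-below : ∀ {n k m} → m < n ∸ k → bitAt (γ n k) m ≡ false
γ-below {n} {k} = bitAt-falses-++ (n ∸ k) (trues k)

γ-above : ∀ {n k m} → k ≤ n → n ∸ k ≤ m → m < n → bitAt (γ n k) m ≡ true
γ-above {n} {k} k≤n a≤m m<n with m≤n⇒∃[o]m+o≡n a≤m
... | r , refl = trans (bitAt-falses-++-+ (n ∸ k) (trues k) r)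
                       (bitAt-trues k (+-cancelˡ-< (n ∸ k) r k (subst (n ∸ k + r <_) (sym (m∸n+n≡m k≤n)) m<n)))

homogeneous-from-γ : ∀ {n k i j} → k ≤ n → Homogeneous (γ n k) i j → i < n → j < n →
                     i ≡ n ∸ k × j < n ∸ k
homogeneous-from-γ {n} {k} {i} {j} k≤n h i<n j<n = ≤-antisym i≤a a≤i , j<a
  where
  a = n ∸ k
  a≤i : a ≤ i
  a≤i = ≮⇒≥ λ i<a → false≢true (trans (sym (γ-below {n} {k} i<a)) (one-at h))
  j<a : j < a
  j<a = ≰⇒> λ a≤j → false≢true (trans (sym (zero-at h)) (γ-above k≤n a≤j j<n))
  i≤a : i ≤ a
  i≤a = ≮⇒≥ λ a<i → false≢true (trans (sym (zeros-between h (a-between a<i)))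
                                      (γ-above k≤n ≤-refl (<-trans a<i i<n)))
    where
    a-between : a < i → Between i j a
    a-between a<i = ≤-<-trans (m⊓n≤n i j) j<a , <-≤-trans a<i (m≤m⊔n i j)

homogeneous-into-γ : ∀ {n k w i j} → k ≤ n → Homogeneous w i j → transpose w i j ≡ γ n k →
                     j < length w → i < n → j < n → j ≡ n ∸ k × i < n ∸ k
homogeneous-into-γ {j = j} k≤n h t≡γ j<|w| i<n j<n =
  homogeneous-from-γ k≤n (subst (λ u → Homogeneous u j _) t≡γ (homogeneous-reverse j<|w| h)) j<n i<n

data Shape : Word → Set where
  sorted : ∀ a b → Shape (falses a ++ trues b)
  slidable : ∀ x m b → Shape (x ++ true ∷ falses (suc m) ++ trues b)

shape : ∀ w → Shape w
shape [] = sorted 0 0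
shape (false ∷ w) with shape w
... | sorted a b = sorted (suc a) b
... | slidable x m b = slidable (false ∷ x) m b
shape (true ∷ w) with shape w
... | sorted zero b = sorted 0 (suc b)
... | sorted (suc a) b = slidable [] a b
... | slidable x m b = slidable (true ∷ x) m b

sorted-InC⇒γ : ∀ {n p k} a b → InC n p k (falses a ++ trues b) → falses a ++ trues b ≡ γ n k
sorted-InC⇒γ a b (refl , refl , _) = cong₂ (λ c d → falses c ++ trues d) a≡ (sym ones≡b)
  where
  ones≡b : ones (falses a ++ trues b) ≡ b
  ones≡b = trans (ones-falses-++ a (trues b)) (ones-trues b)
  length≡ : length (falses a ++ trues b) ≡ a + b
  length≡ = trans (length-falses-++ a (trues b)) (cong (a +_) (length-replicate b))
  a≡ : a ≡ length (falses a ++ trues b) ∸ ones (falses a ++ trues b)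
  a≡ = sym (trans (cong₂ _∸_ length≡ ones≡b) (m+n∸n≡m a b))

EndsWithOnes : ℕ → Word → Set
EndsWithOnes s u = ∃ λ z → u ≡ z ++ trues s

endsWithOnes-weaken : ∀ {s t u} → s ≤ t → EndsWithOnes t u → EndsWithOnes s u
endsWithOnes-weaken {s} s≤t (z , refl) with m≤n⇒∃[o]m+o≡n s≤t
... | o , refl = z ++ trues o , (begin
  z ++ trues (s + o)          ≡⟨ cong (λ l → z ++ trues l) (+-comm s o) ⟩
  z ++ trues (o + s)          ≡⟨ cong (z ++_) (replicate-+ o s true) ⟩
  z ++ trues o ++ trues s     ≡⟨ ++-assoc z (trues o) (trues s) ⟨
  (z ++ trues o) ++ trues s   ∎)
  where open ≡-Reasoning

¬endsWithOnes-past-zero : ∀ y b → ¬ EndsWithOnes (suc b) (y ++ false ∷ trues b)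
¬endsWithOnes-past-zero y b (z , e) = false≢true (begin
  false                                          ≡⟨ bitAt-++ʳ y (false ∷ trues b) 0 ⟨
  bitAt (y ++ false ∷ trues b) (length y + 0)    ≡⟨ cong₂ bitAt e (cong (_+ 0) |y|≡|z|) ⟩
  bitAt (z ++ trues (suc b)) (length z + 0)      ≡⟨ bitAt-++ʳ z (trues (suc b)) 0 ⟩
  true                                           ∎)
  where
  open ≡-Reasoning
  |y|≡|z| : length y ≡ length z
  |y|≡|z| = +-cancelʳ-≡ (length (trues (suc b))) (length y) (length z)
              (trans (sym (length-++ y)) (trans (cong length e) (length-++ z)))

endsWithOnes-bound : ∀ {s} y b → EndsWithOnes s (y ++ false ∷ trues b) → s ≤ b
endsWithOnes-bound y b e = ≮⇒≥ λ b<s → ¬endsWithOnes-past-zero y b (endsWithOnes-weaken b<s e)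

slidable-trailing-≤ : ∀ x m b {s} → EndsWithOnes s (x ++ true ∷ falses (suc m) ++ trues b) → s ≤ b
slidable-trailing-≤ x m b e =
  endsWithOnes-bound (x ++ true ∷ falses m) b (subst (EndsWithOnes _) (slidable-≡-zero x m (trues b)) e)

endsWithOnes-setAt-true : ∀ {s u} j → EndsWithOnes s u → EndsWithOnes s (setAt u j true)
endsWithOnes-setAt-true {s} j (z , refl) = go z j
  where
  go : ∀ z j → EndsWithOnes s (setAt (z ++ trues s) j true)
  go [] j = [] , setAt-trues s j
  go (c ∷ z) zero = true ∷ z , refl
  go (c ∷ z) (suc j) with go z j
  ... | z' , e = c ∷ z' , cong (c ∷_) e

transpose-endsWithOnes : ∀ {s} y {i} j → i < length y → EndsWithOnes s (transpose (y ++ trues s) i j)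
transpose-endsWithOnes y j i<n = endsWithOnes-setAt-true j (_ , setAt-++ˡ y _ false i<n)

-- The greedy choice

_<ₗₑₓ_ : ℕ × ℕ → ℕ × ℕ → Set
_<ₗₑₓ_ = ×-Lex _≡_ _<_ _<_

<ₗₑₓ-asym : ∀ {q q'} → q <ₗₑₓ q' → ¬ q' <ₗₑₓ q
<ₗₑₓ-asym {q} {q'} = ×-asymmetric sym <-resp₂-≡ <-asym <-asym {q} {q'}

pairs-sorted : ∀ n → AllPairs _<ₗₑₓ_ (pairs n)
pairs-sorted n = AllPairs.concat⁺ (map⁺ (All.universal row-sorted (upTo n)))
                   (AllPairs.map⁺ (AllPairs.applyUpTo⁺₁ (λ i → i) n λ i<i' _ → rows-ordered i<i'))
  where
  row : ℕ → List (ℕ × ℕ)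
  row i = map (i ,_) (upTo n)
  row-sorted : ∀ i → AllPairs _<ₗₑₓ_ (row i)
  row-sorted i = AllPairs.map⁺ (AllPairs.applyUpTo⁺₁ (λ j → j) n λ j<j' _ → inj₂ (refl , j<j'))
  rows-ordered : ∀ {i i'} → i < i' → All (λ q → All (q <ₗₑₓ_) (row i')) (row i)
  rows-ordered i<i' = map⁺ (All.universal (λ _ → map⁺ (All.universal (λ _ → inj₁ i<i') (upTo n))) (upTo n))

∈-pairs : ∀ {n i j} → i < n → j < n → (i , j) ∈ pairs n
∈-pairs {n} {i} i<n j<n =
  ∈-concatMap⁺ (λ i → map (i ,_) (upTo n))
               (Any.map (λ { refl → ∈-map⁺ (i ,_) (∈-upTo⁺ j<n) }) (∈-upTo⁺ i<n))

pairs-bounded : ∀ {n i j} → (i , j) ∈ pairs n → i < n × j < n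
pairs-bounded {n} q∈ with find (∈-concatMap⁻ (λ i → map (i ,_) (upTo n)) q∈)
... | i , i∈ , row∈ with ∈-map⁻ (i ,_) row∈
... | j , j∈ , refl = ∈-upTo⁻ i∈ , ∈-upTo⁻ j∈

module Greedy (n p k : ℕ) where

  ValidMove : List Word → Word → ℕ × ℕ → Set
  ValidMove L w (i , j) = homog w i j ≡ true × InC n p k (transpose w i j) × transpose w i j ∉ L

  data FirstNewStep (L : List Word) (w : Word) (i j : ℕ) (ps : List (ℕ × ℕ)) : Maybe Word → Set where
    hit : ValidMove L w (i , j) → FirstNewStep L w i j ps (just (transpose w i j))
    skip : ¬ ValidMove L w (i , j) → FirstNewStep L w i j ps (firstNew n p k L w ps)

  firstNew-step : ∀ L w i j ps → FirstNewStep L w i j ps (firstNew n p k L w ((i , j) ∷ ps))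
  firstNew-step L w i j ps with homog w i j in h
  ... | false = skip λ (h' , _) → false≢true (trans (sym h) h')
  ... | true with InC? n p k (transpose w i j)
  ...   | no ¬c = skip λ (_ , c , _) → ¬c c
  ...   | yes c with transpose w i j ∈? L
  ...     | yes t∈L = skip λ (_ , _ , t∉L) → t∉L t∈L
  ...     | no t∉L = hit (h , c , t∉L)

  firstNew-nothing : ∀ {L w} ps → firstNew n p k L w ps ≡ nothing → ∀ {q} → q ∈ ps → ¬ ValidMove L w q
  firstNew-nothing {L} {w} ((i , j) ∷ ps) e q∈
    with firstNew n p k L w ((i , j) ∷ ps) | firstNew-step L w i j ps | e | q∈
  ... | _ | skip ¬v | _ | here refl = ¬v
  ... | _ | skip _ | e | there q∈ps = firstNew-nothing ps e q∈ps

  record LeftmostMove (L : List Word) (w w' : Word) (ps : List (ℕ × ℕ)) : Set where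
    field
      source target : ℕ
      listed : (source , target) ∈ ps
      valid : ValidMove L w (source , target)
      result : w' ≡ transpose w source target
      leftmost : ∀ {q} → q ∈ ps → q <ₗₑₓ (source , target) → ¬ ValidMove L w q

  firstNew-just : ∀ {L w w'} ps → AllPairs _<ₗₑₓ_ ps → firstNew n p k L w ps ≡ just w' →
                  LeftmostMove L w w' ps
  firstNew-just {L} {w} ((i , j) ∷ ps) (first ∷ rest) e
    with firstNew n p k L w ((i , j) ∷ ps) | firstNew-step L w i j ps | e
  ... | _ | hit v | e = record
    { source = i ; target = j ; listed = here refl ; valid = v
    ; result = sym (just-injective e)
    ; leftmost = λ { (here refl) q<q _ → <ₗₑₓ-asym q<q q<q
                   ; (there q∈) q<ij _ → <ₗₑₓ-asym (All.lookup first q∈) q<ij }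
    }
  ... | _ | skip ¬v | e = record
    { source = source move ; target = target move ; listed = there (listed move)
    ; valid = valid move ; result = result move
    ; leftmost = λ { (here refl) _ → ¬v ; (there q∈) → leftmost move q∈ }
    }
    where
    move = firstNew-just ps rest e
    open LeftmostMove

-- Counting distinct words

allWords : ℕ → List Word
allWords zero = [ [] ]
allWords (suc n) = map (false ∷_) (allWords n) ++ map (true ∷_) (allWords n)

length-allWords : ∀ n → length (allWords n) ≡ 2 ^ n
length-allWords zero = refl
length-allWords (suc n) = begin
  length (map (false ∷_) (allWords n) ++ map (true ∷_) (allWords n))
    ≡⟨ length-++ (map (false ∷_) (allWords n)) ⟩
  length (map (false ∷_) (allWords n)) + length (map (true ∷_) (allWords n))
    ≡⟨ cong₂ _+_ (length-map (false ∷_) (allWords n)) (length-map (true ∷_) (allWords n)) ⟩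
  length (allWords n) + length (allWords n)
    ≡⟨ cong₂ _+_ (length-allWords n) (trans (length-allWords n) (sym (+-identityʳ (2 ^ n)))) ⟩
  2 ^ suc n ∎
  where open ≡-Reasoning

∈-allWords : ∀ w → w ∈ allWords (length w)
∈-allWords [] = here refl
∈-allWords (false ∷ w) = ∈-++⁺ˡ (∈-map⁺ (false ∷_) (∈-allWords w))
∈-allWords (true ∷ w) = ∈-++⁺ʳ (map (false ∷_) (allWords (length w))) (∈-map⁺ (true ∷_) (∈-allWords w))

unique-⊆⇒length-≤ : ∀ {A : Set} {xs ys : List A} → Unique xs → xs ⊆ ys → length xs ≤ length ys
unique-⊆⇒length-≤ [] _ = z≤n
unique-⊆⇒length-≤ {xs = x ∷ xs} (x∉xs ∷ u) xs⊆ys with ∈-∃++ (xs⊆ys (here refl))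
... | ys₁ , ys₂ , refl = begin
  suc (length xs)                 ≤⟨ s≤s (unique-⊆⇒length-≤ u xs⊆ys₁ys₂) ⟩
  suc (length (ys₁ ++ ys₂))       ≡⟨ cong suc (length-++ ys₁) ⟩
  suc (length ys₁ + length ys₂)   ≡⟨ +-suc (length ys₁) (length ys₂) ⟨
  length ys₁ + suc (length ys₂)   ≡⟨ length-++ ys₁ ⟨
  length (ys₁ ++ x ∷ ys₂)         ∎
  where
  open ≤-Reasoning
  xs⊆ys₁ys₂ : xs ⊆ ys₁ ++ ys₂
  xs⊆ys₁ys₂ v∈xs with ∈-++⁻ ys₁ (xs⊆ys (there v∈xs))
  ... | inj₁ v∈ys₁ = ∈-++⁺ˡ v∈ys₁
  ... | inj₂ (here refl) = ⊥-elim (All.lookup x∉xs v∈xs refl)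
  ... | inj₂ (there v∈ys₂) = ∈-++⁺ʳ ys₁ v∈ys₂

unique-words-bound : ∀ {n L} → Unique L → All (λ u → length u ≡ n) L → length L ≤ 2 ^ n
unique-words-bound {n} {L} u lengths = subst (length L ≤_) (length-allWords n) (unique-⊆⇒length-≤ u L⊆allWords)
  where
  L⊆allWords : L ⊆ allWords n
  L⊆allWords {v} v∈L = subst (λ m → v ∈ allWords m) (All.lookup lengths v∈L) (∈-allWords v)

-- The greedy run

last-∷ʳ : ∀ {A : Set} (L : List A) w → last (L ++ [ w ]) ≡ just w
last-∷ʳ [] w = refl
last-∷ʳ (u ∷ []) w = refl
last-∷ʳ (u ∷ v ∷ L) w = last-∷ʳ (v ∷ L) w

last-∈ : ∀ {A : Set} {L : List A} {w} → last L ≡ just w → w ∈ L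
last-∈ {L = u ∷ []} refl = here refl
last-∈ {L = u ∷ v ∷ L} e = there (last-∈ e)

module Run (n p k : ℕ) (k≤n : k ≤ n) where

  open Greedy n p k
  open LeftmostMove

  γ-terminal : ∀ {L w w'} → w ∈ L → length w ≡ n → LeftmostMove L w w' (pairs n) → w' ≡ γ n k →
               ∀ {q} → q ∈ pairs n → ¬ ValidMove (L ++ [ w' ]) w' q
  γ-terminal {L} {w} w∈L |w|≡n move refl {i' , j'} q∈ (h' , c' , new') = conclude (j' ≟ i)
    where
    g = γ n k
    a = n ∸ k
    i = source move
    j = target move
    hom = homog-sound w i j (proj₁ (valid move))
    i<n = proj₁ (pairs-bounded (listed move))
    j<n = proj₂ (pairs-bounded (listed move))
    into-γ = homogeneous-into-γ k≤n hom (sym (result move)) (subst (j <_) (sym |w|≡n) j<n) i<n j<n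
    j≡a = proj₁ into-γ
    i<a = proj₂ into-γ
    i'<n = proj₁ (pairs-bounded q∈)
    j'<n = proj₂ (pairs-bounded q∈)
    from-γ = homogeneous-from-γ k≤n (homog-sound g i' j' h') i'<n j'<n
    i'≡a = proj₁ from-γ
    j'<a = proj₂ from-γ

    w≡ : w ≡ transpose g a i
    w≡ = begin
      w                              ≡⟨ transpose-involutive w (one-at hom) (zero-at hom) (source≢target hom) ⟨
      transpose (transpose w i j) j i ≡⟨ cong₂ (λ u b → transpose u b i) (sym (result move)) j≡a ⟩
      transpose g a i                ∎
      where open ≡-Reasoning

    w-below : ∀ {m} → m < a → m ≢ i → bitAt w m ≡ false
    w-below {m} m<a m≢i = begin
      bitAt w m                 ≡⟨ cong (λ u → bitAt u m) w≡ ⟩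
      bitAt (transpose g a i) m ≡⟨ bitAt-transpose-other g (<⇒≢ m<a) m≢i ⟩
      bitAt g m                 ≡⟨ γ-below {n} {k} m<a ⟩
      false                     ∎
      where open ≡-Reasoning

    conclude : Dec (j' ≡ i) → ⊥
    conclude (yes j'≡i) = new' (∈-++⁺ˡ (subst (_∈ L) (trans w≡ (sym (cong₂ (transpose g) i'≡a j'≡i))) w∈L))
    conclude (no j'≢i) =
      leftmost move (∈-pairs i<n j'<n) (inj₂ (refl , subst (j' <_) (sym j≡a) j'<a)) valid-w
      where
      t≡ : transpose w i j' ≡ transpose g i' j'
      t≡ = begin
        transpose w i j'                 ≡⟨ cong (λ u → transpose u i j') w≡ ⟩
        transpose (transpose g a i) i j' ≡⟨ transpose-transpose g j' (<⇒≢ i<a) (γ-below {n} {k} i<a) ⟩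
        transpose g a j'                 ≡⟨ cong (λ b → transpose g b j') i'≡a ⟨
        transpose g i' j'                ∎
        where open ≡-Reasoning
      hom' : Homogeneous w i j'
      hom' = record
        { one-at = one-at hom
        ; zero-at = w-below j'<a j'≢i
        ; zeros-between = λ b → w-below (<-trans (proj₂ b) (⊔-lub i<a j'<a)) (between-≢ˡ b)
        }
      valid-w : ValidMove L w (i , j')
      valid-w = homog-complete hom' , subst (InC n p k) (sym t≡) c' ,
                λ t∈L → new' (∈-++⁺ˡ (subst (_∈ L) t≡ t∈L))

  record Invariant (L : List Word) (w : Word) : Set where
    field
      ends-with : last L ≡ just w
      all-in-C : All (InC n p k) L
      distinct : Unique L
      trailing-max : ∀ {u s} → u ∈ L → EndsWithOnes s u → EndsWithOnes s w
      γ-final : w ≡ γ n k → ∀ {q} → q ∈ pairs n → ¬ ValidMove L w q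

    in-C : InC n p k w
    in-C = All.lookup all-in-C (last-∈ ends-with)

  open Invariant

  slide-listed : ∀ x m (y : Word) → length (x ++ true ∷ falses (suc m) ++ y) ≡ n →
                 (length x , length x + suc m) ∈ pairs n
  slide-listed x m y |w|≡n = ∈-pairs (≤-<-trans (m≤m+n (length x) (suc m)) t<n) t<n
    where
    t<n = subst (length x + suc m <_) |w|≡n (slide-target<length x m y)

  slide-valid : ∀ {L} x m b → Invariant L (x ++ true ∷ falses (suc m) ++ trues b) →
                ValidMove L (x ++ true ∷ falses (suc m) ++ trues b) (length x , length x + suc m)
  slide-valid x m b inv =
    homog-complete (slide-homogeneous x m (trues b)) ,
    subst (InC n p k) (sym (slide-transpose x m (trues b))) (InC-slide {p = p} x (suc m) (trues b) (in-C inv)) ,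
    new
    where
    slid-ends : EndsWithOnes (suc b) (x ++ falses (suc m) ++ true ∷ trues b)
    slid-ends = x ++ falses (suc m) , sym (++-assoc x (falses (suc m)) (trues (suc b)))
    new : transpose (x ++ true ∷ falses (suc m) ++ trues b) (length x) (length x + suc m) ∉ _
    new t∈L = 1+n≰n (slidable-trailing-≤ x m b
                (trailing-max inv t∈L (subst (EndsWithOnes (suc b)) (sym (slide-transpose x m (trues b))) slid-ends)))

  stuck⇒γ : ∀ {L w} → Invariant L w → greedyNext n p k L w ≡ nothing → w ≡ γ n k
  stuck⇒γ {L} {w} inv stuck with shape w
  ... | sorted a b = sorted-InC⇒γ {p = p} a b (in-C inv)
  ... | slidable x m b = ⊥-elim
    (firstNew-nothing (pairs n) stuck (slide-listed x m (trues b) (proj₁ (in-C inv))) (slide-valid x m b inv))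

  step : ∀ {L w w'} → Invariant L w → greedyNext n p k L w ≡ just w' → Invariant (L ++ [ w' ]) w'
  step {L} {w} {w'} inv next with shape w | firstNew-just (pairs n) (pairs-sorted n) next
  ... | sorted a b | move = ⊥-elim (γ-final inv (sorted-InC⇒γ {p = p} a b (in-C inv)) (listed move) (valid move))
  ... | slidable x m b | move = record
    { ends-with = last-∷ʳ L w'
    ; all-in-C = ∷ʳ⁺ (all-in-C inv) (subst (InC n p k) (sym (result move)) (proj₁ (proj₂ (valid move))))
    ; distinct = Unique.++⁺ (distinct inv) ([] ∷ []) λ { (w'∈L , here refl) → new w'∈L }
    ; trailing-max = trailing-max'
    ; γ-final = γ-terminal (last-∈ (ends-with inv)) (proj₁ (in-C inv)) move
    }
    where
    i = source move
    new : w' ∉ L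
    new w'∈L = proj₂ (proj₂ (valid move)) (subst (_∈ L) (result move) w'∈L)
    i≤|x| : i ≤ length x
    i≤|x| = ≮⇒≥ λ |x|<i →
      leftmost move (slide-listed x m (trues b) (proj₁ (in-C inv))) (inj₁ |x|<i) (slide-valid x m b inv)
    w'-ends : EndsWithOnes b w'
    w'-ends = subst (EndsWithOnes b) (sym w'≡) (transpose-endsWithOnes (x ++ true ∷ falses (suc m)) (target move) i<)
      where
      w'≡ : w' ≡ transpose ((x ++ true ∷ falses (suc m)) ++ trues b) i (target move)
      w'≡ = trans (result move) (cong (λ u → transpose u i (target move)) (slidable-≡-block x m (trues b)))
      i< : i < length (x ++ true ∷ falses (suc m))
      i< = subst (i <_) (sym (length-++ x)) (≤-<-trans i≤|x| (m<m+n (length x) z<s))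
    trailing-max' : ∀ {u s} → u ∈ L ++ [ w' ] → EndsWithOnes s u → EndsWithOnes s w'
    trailing-max' u∈ e with ∈-++⁻ L u∈
    ... | inj₁ u∈L = endsWithOnes-weaken (slidable-trailing-≤ x m b (trailing-max inv u∈L e)) w'-ends
    ... | inj₂ (here refl) = e

  reaches-γ : ∀ f {L w} → Invariant L w → 2 ^ n < length L + f → last (run n p k f L w) ≡ just (γ n k)
  reaches-γ zero {L} inv fuel = ⊥-elim (<⇒≱ (subst (2 ^ n <_) (+-identityʳ (length L)) fuel)
                                          (unique-words-bound (distinct inv) (All.map proj₁ (all-in-C inv))))
  reaches-γ (suc f) {L} {w} inv fuel with greedyNext n p k L w in next
  ... | nothing = trans (ends-with inv) (cong just (stuck⇒γ inv next))
  ... | just w' = reaches-γ f (step inv next) (subst (2 ^ n <_) fuel≡ fuel)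
    where
    fuel≡ : length L + suc f ≡ length (L ++ [ w' ]) + f
    fuel≡ = trans (+-suc (length L) f) (cong (_+ f) (trans (+-comm 1 (length L)) (sym (length-++ L))))

  initial : ∀ {α} → InC n p k α → α ≢ γ n k → Invariant [ α ] α
  initial cα α≢γ = record
    { ends-with = refl
    ; all-in-C = cα ∷ []
    ; distinct = [] ∷ []
    ; trailing-max = λ { (here refl) e → e }
    ; γ-final = λ α≡γ → ⊥-elim (α≢γ α≡γ)
    }

lemma10 : (p n k : ℕ) → n ≥ suc p * k → (α : Word) → InC n p k α → α ≢ γ n k →
          last (D p n k α) ≡ just (γ n k)
lemma10 p n k n≥ α cα α≢γ = Run.reaches-γ n p k k≤n (2 ^ n) (Run.initial n p k k≤n cα α≢γ) ≤-refl
  where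
  k≤n : k ≤ n
  k≤n = ≤-trans (m≤m+n k (p * k)) n≥
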